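{- Let $S$ and $T$ be rooted binary trees on the vertex set $\{1,\dots,n\}$, each labeled in infix order. Let $L_S, L_T$ be their numbers of maximal left chains and $R_S, R_T$ their numbers of maximal right chains. Then the chain distance satisfies $$C(S,T) \le \min(L_S+L_T-2,\; R_S+R_T-2).$$
   Context: Trees are rooted binary trees (each vertex has at most one left child and at most one right child). Their $n$ vertices are identified with $1,\dots,n$ in infix (in-order) order, as in a binary search tree. A subtree rooted at a vertex $x$ consists of $x$ and all its descendants. A left chain $[u$-$v]$ is a nonempty sequence of vertices $u=x_1,\dots,x_k=v$ with $x_{i+1}$ the left child of $x_i$; a single vertex counts as a chain. A maximal left chain is one not contained in any other left chain. Right chains are defined symmetrically. A direct c-rotation $\mathrm{rot}([u$-$v],w)$ applies when $[u$-$v]$ is a left chain (not necessarily maximal) and $u$ is the right child of $w$. Its effect: (i) $u$ takes the place of $w$: it becomes the child of $w$'s former parent on the same side, or the root if $w$ was the root; (ii) $w$ becomes the left child of $v$; (iii) the former left subtree of $v$, if any, becomes the right subtree of $w$ (if there is none, $w$'s right child becomes empty). All other child pointers are unchanged. An inverse c-rotation $\mathrm{rot}(w,[u$-$v])$ applies when $[u$-$v]$ is a left chain and $w$ is the left child of $v$. Its effect: (i) $w$ takes the place of $u$: it becomes the child of $u$'s former parent on the same side, or the root; (ii) $u$ becomes the right child of $w$; (iii) the former right subtree of $w$, if any, becomes the left subtree of $v$ (otherwise $v$'s left child becomes empty). All other pointers are unchanged. The same two operations are also defined for right chains, with "left" and "right" interchanged throughout. These are the c-rotations; each of them preserves the infix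 order. The chain distance $C(S,T)$ is the minimum number of c-rotations (direct or inverse) needed to transform $S$ into $T$. -}

module Defs where

open import Data.Nat using (ℕ; zero; suc; _+_; _≤_)
open import Data.Product using (Σ; _×_)
open import Data.Bool using (Bool; true; false; if_then_else_)
open import Data.List using (List; []; _∷_)

-- Vertices are the
-- 'node's; they are identified with 1..n by their infix (in-order) position,
-- so the labelling is implicit in the shape.  'node l r' has left subtree l
-- and right subtree r.
data Tree : Set where
  leaf : Tree
  node : Tree → Tree → Tree

size : Tree → ℕ
size leaf = 0
size (node l r) = suc (size l + size r)

-- A left chain x1,...,xk (k ≥ 1, x_{i+1} the left child of x_i), where x_i has
-- right subtree B_i (given as B1 and the list B2..Bk) and x_k = v has left
-- subtree D.
leftChain : Tree → List Tree → Tree → Tree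
leftChain B [] D = node D B
leftChain B (B' ∷ Bs) D = node (leftChain B' Bs D) B

-- Mirror: a right chain; x_i has left subtree B_i, x_k has right subtree D.
rightChain : Tree → List Tree → Tree → Tree
rightChain B [] D = node B D
rightChain B (B' ∷ Bs) D = node B (rightChain B' Bs D)

-- Direct c-rotations performed at the subtree rooted at w.
--  left chains : w = node A (chain [u-v]) ; afterwards u takes w's place, w
--                becomes the left child of v with left subtree A and right
--                subtree the former left subtree D of v.
--  right chains: the mirror image.
data DirectRot : Tree → Tree → Set where
  dirL : ∀ A B Bs D → DirectRot (node A (leftChain B Bs D)) (leftChain B Bs (node A D))
  dirR : ∀ A B Bs D → DirectRot (node (rightChain B Bs D) A) (rightChain B Bs (node D A))

data CRot : Tree → Tree → Set where
  direct  : ∀ {S T} → DirectRot S T → CRot S T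
  inverse : ∀ {S T} → DirectRot T S → CRot S T
  inLeft  : ∀ {l l' r} → CRot l l' → CRot (node l r) (node l' r)
  inRight : ∀ {l r r'} → CRot r r' → CRot (node l r) (node l r')

data CPath : ℕ → Tree → Tree → Set where
  done : ∀ {S} → CPath zero S S
  step : ∀ {k S U T} → CRot S U → CPath k U T → CPath (suc k) S T

-- C(S,T) ≤ m  :⇔  some sequence of at most m c-rotations transforms S into T
-- (C is the minimum length of such a sequence).
_≤C[_,_] : ℕ → Tree → Tree → Set
m ≤C[ S , T ] = Σ ℕ (λ k → (k ≤ m) × CPath k S T)

-- Every vertex lies in exactly one maximal left chain, whose top is the unique
-- vertex of that chain that is not a left child.  So the maximal left chains
-- are counted by counting vertices that are not left children.
-- The Bool records whether the root of the given subtree is a left child.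
leftChainsAux : Bool → Tree → ℕ
leftChainsAux b leaf = 0
leftChainsAux b (node l r) = (if b then 0 else 1) + leftChainsAux true l + leftChainsAux false r

numLeftChains : Tree → ℕ
numLeftChains = leftChainsAux false

-- symmetric: the Bool records whether the root is a right child
rightChainsAux : Bool → Tree → ℕ
rightChainsAux b leaf = 0
rightChainsAux b (node l r) = (if b then 0 else 1) + rightChainsAux false l + rightChainsAux true r

numRightChains : Tree → ℕ
numRightChains = rightChainsAux false

-- Every tree on n vertices can be rotated into the left comb (a single left
-- chain) using one c-rotation per maximal left chain other than the one through
-- the root: once the left and right subtrees of a vertex are combs, one direct
-- c-rotation hangs the vertex with its left comb below the right comb.  Going
-- from S to the comb and back to T costs L_S - 1 + L_T - 1.  The bound for
-- right chains is the mirror image.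
module Submission where

open import Defs
open import Data.Nat using (ℕ; zero; suc; _≤_; _+_; _∸_; _⊓_; z≤n)
open import Data.Nat.Properties
open import Data.Bool using (true; false; if_then_else_)
open import Data.List using ([]; _∷_; map; replicate)
open import Data.Product using (_,_)
open import Data.Sum using (inj₁; inj₂)
open import Relation.Binary.PropositionalEquality
  using (_≡_; refl; sym; trans; cong; cong₂; subst; subst₂; module ≡-Reasoning)
open ≡-Reasoning

_++ᶜ_ : ∀ {a b S U T} → CPath a S U → CPath b U T → CPath (a + b) S T
done ++ᶜ q = q
step r p ++ᶜ q = step r (p ++ᶜ q)

CRot-sym : ∀ {S T} → CRot S T → CRot T S
CRot-sym (direct d) = inverse d
CRot-sym (inverse d) = direct d
CRot-sym (inLeft r) = inLeft (CRot-sym r)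
CRot-sym (inRight r) = inRight (CRot-sym r)

CPath-sym : ∀ {k S T} → CPath k S T → CPath k T S
CPath-sym done = done
CPath-sym {suc k} {S} {T} (step r p) =
  subst (λ j → CPath j T S) (+-comm k 1) (CPath-sym p ++ᶜ step (CRot-sym r) done)

CPath-map : (f : Tree → Tree) → (∀ {S T} → CRot S T → CRot (f S) (f T)) →
  ∀ {k S T} → CPath k S T → CPath k (f S) (f T)
CPath-map f f-rot done = done
CPath-map f f-rot (step r p) = step (f-rot r) (CPath-map f f-rot p)

≤C-reflexive : ∀ {S T} → S ≡ T → 0 ≤C[ S , T ]
≤C-reflexive refl = 0 , z≤n , done

≤C-rot : ∀ {S T} → CRot S T → 1 ≤C[ S , T ]
≤C-rot r = 1 , ≤-refl , step r done

≤C-trans : ∀ {a b S U T} → a ≤C[ S , U ] → b ≤C[ U , T ] → (a + b) ≤C[ S , T ]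
≤C-trans (j , j≤a , p) (k , k≤b , q) = j + k , +-mono-≤ j≤a k≤b , p ++ᶜ q

≤C-sym : ∀ {a S T} → a ≤C[ S , T ] → a ≤C[ T , S ]
≤C-sym (k , k≤a , p) = k , k≤a , CPath-sym p

≤C-weaken : ∀ {a b S T} → a ≤ b → a ≤C[ S , T ] → b ≤C[ S , T ]
≤C-weaken a≤b (k , k≤a , p) = k , ≤-trans k≤a a≤b , p

≤C-⊓ : ∀ {a b S T} → a ≤C[ S , T ] → b ≤C[ S , T ] → (a ⊓ b) ≤C[ S , T ]
≤C-⊓ {a} {b} d e with ⊓-sel a b
... | inj₁ a⊓b≡a = subst (_≤C[ _ , _ ]) (sym a⊓b≡a) d
... | inj₂ a⊓b≡b = subst (_≤C[ _ , _ ]) (sym a⊓b≡b) e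

≤C-node : ∀ {a b l l' r r'} → a ≤C[ l , l' ] → b ≤C[ r , r' ] →
  (a + b) ≤C[ node l r , node l' r' ]
≤C-node (j , j≤a , p) (k , k≤b , q) =
  j + k , +-mono-≤ j≤a k≤b , CPath-map (λ t → node t _) inLeft p ++ᶜ CPath-map (node _) inRight q

leftComb : ℕ → Tree
leftComb zero = leaf
leftComb (suc n) = node (leftComb n) leaf

leftChain-leftComb : ∀ m j → leftChain leaf (replicate m leaf) (leftComb j) ≡ leftComb (suc m + j)
leftChain-leftComb zero j = refl
leftChain-leftComb (suc m) j = cong (λ t → node t leaf) (leftChain-leftComb m j)

leftComb-merge : ∀ a b → 1 ≤C[ node (leftComb a) (leftComb (suc b)) , leftComb (suc (a + suc b)) ]
leftComb-merge a b = subst₂ (λ U V → 1 ≤C[ node (leftComb a) U , V ])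
  (trans (leftChain-leftComb b 0) (cong leftComb (cong suc (+-identityʳ b))))
  (trans (leftChain-leftComb b (suc a)) (cong leftComb (+-comm (suc b) (suc a))))
  (≤C-rot (direct (dirL (leftComb a) leaf (replicate b leaf) leaf)))

-- leftChainsAux true t counts the maximal left chains of t except the one
-- through its root.
toLeftComb : ∀ t → leftChainsAux true t ≤C[ t , leftComb (size t) ]
toLeftComb leaf = ≤C-reflexive refl
toLeftComb (node l leaf) =
  subst (λ n → (leftChainsAux true l + 0) ≤C[ node l leaf , leftComb (suc n) ])
    (sym (+-identityʳ (size l)))
    (≤C-node (toLeftComb l) (≤C-reflexive refl))
toLeftComb (node l r@(node r₁ r₂)) =
  ≤C-weaken (≤-reflexive (trans (+-assoc kl kr 1) (cong (kl +_) (+-comm kr 1))))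
    (≤C-trans (≤C-node (toLeftComb l) (toLeftComb r)) (leftComb-merge (size l) (size r₁ + size r₂)))
  where
  kl = leftChainsAux true l
  kr = leftChainsAux true r

leftChains-bound : ∀ S T → size S ≡ size T →
  (numLeftChains S + numLeftChains T ∸ 2) ≤C[ S , T ]
leftChains-bound leaf leaf _ = ≤C-reflexive refl
leftChains-bound leaf (node _ _) ()
leftChains-bound (node _ _) leaf ()
leftChains-bound S@(node _ _) T@(node _ _) |S|≡|T| =
  subst (_≤C[ S , T ]) (sym (cong (_∸ 1) (+-suc (leftChainsAux true S) (leftChainsAux true T))))
    (≤C-trans (toLeftComb S)
      (subst (λ n → leftChainsAux true T ≤C[ leftComb n , T ]) (sym |S|≡|T|)
        (≤C-sym (toLeftComb T))))

mirror : Tree → Tree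
mirror leaf = leaf
mirror (node l r) = node (mirror r) (mirror l)

mirror-involutive : ∀ t → mirror (mirror t) ≡ t
mirror-involutive leaf = refl
mirror-involutive (node l r) = cong₂ node (mirror-involutive l) (mirror-involutive r)

size-mirror : ∀ t → size (mirror t) ≡ size t
size-mirror leaf = refl
size-mirror (node l r) = cong suc (trans (cong₂ _+_ (size-mirror r) (size-mirror l)) (+-comm (size r) (size l)))

leftChainsAux-mirror : ∀ b t → leftChainsAux b (mirror t) ≡ rightChainsAux b t
leftChainsAux-mirror b leaf = refl
leftChainsAux-mirror b (node l r) = begin
  c + leftChainsAux true (mirror r) + leftChainsAux false (mirror l)
    ≡⟨ cong₂ (λ x y → c + x + y) (leftChainsAux-mirror true r) (leftChainsAux-mirror false l) ⟩
  c + rightChainsAux true r + rightChainsAux false l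
    ≡⟨ +-assoc c _ _ ⟩
  c + (rightChainsAux true r + rightChainsAux false l)
    ≡⟨ cong (c +_) (+-comm (rightChainsAux true r) _) ⟩
  c + (rightChainsAux false l + rightChainsAux true r)
    ≡⟨ sym (+-assoc c _ _) ⟩
  c + rightChainsAux false l + rightChainsAux true r ∎
  where c = if b then 0 else 1

mirror-leftChain : ∀ B Bs D →
  mirror (leftChain B Bs D) ≡ rightChain (mirror B) (map mirror Bs) (mirror D)
mirror-leftChain B [] D = refl
mirror-leftChain B (B' ∷ Bs) D = cong (node (mirror B)) (mirror-leftChain B' Bs D)

mirror-rightChain : ∀ B Bs D →
  mirror (rightChain B Bs D) ≡ leftChain (mirror B) (map mirror Bs) (mirror D)
mirror-rightChain B [] D = refl
mirror-rightChain B (B' ∷ Bs) D = cong (λ t → node t (mirror B)) (mirror-rightChain B' Bs D)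

mirror-DirectRot : ∀ {S T} → DirectRot S T → DirectRot (mirror S) (mirror T)
mirror-DirectRot (dirL A B Bs D) =
  subst₂ DirectRot
    (sym (cong (λ t → node t (mirror A)) (mirror-leftChain B Bs D)))
    (sym (mirror-leftChain B Bs (node A D)))
    (dirR (mirror A) (mirror B) (map mirror Bs) (mirror D))
mirror-DirectRot (dirR A B Bs D) =
  subst₂ DirectRot
    (sym (cong (node (mirror A)) (mirror-rightChain B Bs D)))
    (sym (mirror-rightChain B Bs (node D A)))
    (dirL (mirror A) (mirror B) (map mirror Bs) (mirror D))

mirror-CRot : ∀ {S T} → CRot S T → CRot (mirror S) (mirror T)
mirror-CRot (direct d) = direct (mirror-DirectRot d)
mirror-CRot (inverse d) = inverse (mirror-DirectRot d)
mirror-CRot (inLeft r) = inRight (mirror-CRot r)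
mirror-CRot (inRight r) = inLeft (mirror-CRot r)

≤C-mirror : ∀ {a S T} → a ≤C[ mirror S , mirror T ] → a ≤C[ S , T ]
≤C-mirror {a} {S} {T} (k , k≤a , p) =
  k , k≤a , subst₂ (CPath k) (mirror-involutive S) (mirror-involutive T) (CPath-map mirror mirror-CRot p)

rightChains-bound : ∀ S T → size S ≡ size T →
  (numRightChains S + numRightChains T ∸ 2) ≤C[ S , T ]
rightChains-bound S T |S|≡|T| =
  subst (_≤C[ S , T ])
    (cong₂ (λ x y → x + y ∸ 2) (leftChainsAux-mirror false S) (leftChainsAux-mirror false T))
    (≤C-mirror (leftChains-bound (mirror S) (mirror T)
      (trans (size-mirror S) (trans |S|≡|T| (sym (size-mirror T))))))

proposition3 : (n : ℕ) → 1 ≤ n → (S T : Tree) → size S ≡ n → size T ≡ n →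
    ((numLeftChains S + numLeftChains T ∸ 2) ⊓ (numRightChains S + numRightChains T ∸ 2)) ≤C[ S , T ]
proposition3 n _ S T |S|≡n |T|≡n =
  ≤C-⊓ (leftChains-bound S T |S|≡|T|) (rightChains-bound S T |S|≡|T|)
  where |S|≡|T| = trans |S|≡n (sym |T|≡n)
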